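{- For $n\geq 2$, the number $\kappa_n$ of kernel positions of rank $n$ in the flat Bernoulli game is $$\kappa_n=\sum_{k=0}^{\lfloor (n-3)/2\rfloor}\ \sum_{\substack{1=i_0<i_1<\cdots<i_{k+1}=n\\ i_{j+1}-i_j\ge 2\ \text{for all } j}}\ \prod_{j=0}^k (i_{j+1}-i_j-2)!\binom{i_{j+1}}{i_j}.$$
   Context: The flat Bernoulli game: positions of rank $n\ge0$ are words $u_1\cdots u_n$ of positive integers with $1\le u_i\le i$ for all $i$. A valid move replaces $u_1\cdots u_n$ by $u_1\cdots u_m$ for some $1\le m<n$ such that $u_{m+1}<u_j$ for all $j>m+1$. Players alternate; a player unable to move loses; kernel positions are positions of Grundy number zero (every valid move from them leads to a non-kernel position). -}

module Defs where

open import Data.Nat using (ℕ; zero; suc; _!; _+_; _*_; _∸_; _≤ᵇ_; _<ᵇ_; _≡ᵇ_)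
open import Data.Nat.DivMod using (_/_)
open import Data.Nat.Combinatorics using (_C_)
open import Data.Bool using (Bool; true; false; _∧_; not; if_then_else_)
open import Data.List using (List; []; _∷_; [_]; _++_; map; concatMap; upTo; length; take; drop)
open import Data.Nat.ListAction using (sum; product)

allB : {A : Set} → (A → Bool) → List A → Bool
allB p []       = true
allB p (x ∷ xs) = p x ∧ allB p xs

oneTo : ℕ → List ℕ
oneTo n = map suc (upTo n)

-- all words u₁⋯uₙ of positive integers with 1 ≤ uᵢ ≤ i (each exactly once)
positions : ℕ → List (List ℕ)
positions zero    = [ [] ]
positions (suc n) = concatMap (λ w → map (λ a → w ++ [ a ]) (oneTo (suc n))) (positions n)

-- m is a valid move from w (w ↦ u₁⋯uₘ): 1 ≤ m < |w| and u_{m+1} < u_j for all j > m+1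
-- (drop m w = u_{m+1} ∷ u_{m+2} ∷ ⋯)
tailAbove : List ℕ → Bool
tailAbove []         = false
tailAbove (a ∷ rest) = allB (λ x → a <ᵇ x) rest

validMove : ℕ → List ℕ → Bool
validMove m w = (1 ≤ᵇ m) ∧ ((m <ᵇ length w) ∧ tailAbove (drop m w))

-- kernel (Grundy value 0) by recursion on rank: every valid move leads to a
-- non-kernel position.  The fuel argument is the rank (moves strictly lower it).
kernelF : ℕ → List ℕ → Bool
kernelF zero    w = true
kernelF (suc f) w =
  allB (λ m → not (validMove m w ∧ kernelF f (take m w))) (upTo (length w))

isKernel : List ℕ → Bool
isKernel w = kernelF (length w) w

κ : ℕ → ℕ
κ n = sum (map (λ w → if isKernel w then 1 else 0) (positions n))

tuples : ℕ → List ℕ → List (List ℕ)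
tuples zero    xs = [ [] ]
tuples (suc l) xs = concatMap (λ x → map (x ∷_) (tuples l xs)) xs

pairsWith : (ℕ → ℕ → ℕ) → List ℕ → List ℕ
pairsWith f (x ∷ y ∷ r) = f x y ∷ pairsWith f (y ∷ r)
pairsWith f _           = []

pairsOk : (ℕ → ℕ → Bool) → List ℕ → Bool
pairsOk p (x ∷ y ∷ r) = p x y ∧ pairsOk p (y ∷ r)
pairsOk p _           = true

firstIs : ℕ → List ℕ → Bool
firstIs a []      = false
firstIs a (x ∷ _) = x ≡ᵇ a

lastIs : ℕ → List ℕ → Bool
lastIs a []          = false
lastIs a (x ∷ [])    = x ≡ᵇ a
lastIs a (_ ∷ y ∷ r) = lastIs a (y ∷ r)

isChain : ℕ → List ℕ → Bool
isChain n c = firstIs 1 c ∧ (lastIs n c ∧ pairsOk (λ i j → (i + 2) ≤ᵇ j) c)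

weight : List ℕ → ℕ
weight c = product (pairsWith (λ i j → ((j ∸ i ∸ 2) !) * (j C i)) c)

innerSum : ℕ → ℕ → ℕ
innerSum n k = sum (map (λ c → if isChain n c then weight c else 0) (tuples (k + 2) (oneTo n)))

-- Σ_{k=0}^{⌊(n-3)/2⌋}: k ranges over 0 … ⌊(n-1)/2⌋ - 1, which is exactly
-- 0 … ⌊(n-3)/2⌋ for n ≥ 1 (and empty when n = 2, where ⌊(n-3)/2⌋ = -1)
rhs : ℕ → ℕ
rhs n = sum (map (innerSum n) (upTo ((n ∸ 1) / 2)))

module Submission where

-- 1. A non-empty position is either a kernel position or has exactly one winning
--    move (a valid move to a kernel position).  Reading a position letter by letter,
--    a three-state automaton (Phase) tracks this, remembering the pivot p = u_{m+1}
--    of the winning cut m: after a kernel position every letter x creates the winning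
--    cut with pivot x, and a non-kernel position becomes a kernel position exactly
--    when a letter x ≤ p arrives.  So kernel positions are read off the phase.
-- 2. Hence the kernel completions of a position depend only on its length and
--    phase.  From a kernel phase at length j the next kernel phase is reached at
--    length j + e + 2 in Σ_i (i+1)(j-i+1)⋯(j-i+e) = e! C(j+e+2, j) ways, an iterated
--    hockey-stick identity for rising factorials.
-- 3. Iterating, kernel completions are counted by weighted chains; κ_n is the chain
--    sum from 1 (all positions of length 1 are kernel positions) to n, and chains
--    with more than ⌊(n-1)/2⌋ steps do not exist.

open import Defs
open import Data.Bool using (Bool; true; false; T; _∧_; not; if_then_else_)
open import Data.Bool.Properties using (∧-zeroʳ; ∧-identityʳ; ∧-assoc)
open import Data.List using (List; []; _∷_; [_]; _∷ʳ_; _++_; map; concatMap; upTo; applyUpTo; length; take; drop; foldl)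
open import Data.List.Properties using (map-∘; map-cong; map-++; length-take; length-++; take-all; drop-all; ++-identityʳ; ++-assoc; foldl-∷ʳ)
open import Data.Nat using (ℕ; zero; suc; _+_; _*_; _∸_; _≤_; _<_; z≤n; s≤s; s≤s⁻¹; z<s; s<s; _!; _≤ᵇ_; _<ᵇ_; _≡ᵇ_; _≤?_; _<?_; _≟_)
open import Data.Nat.Properties
open import Data.Nat.Induction using (<-rec)
open import Data.Nat.Combinatorics using (_C_; nCk≡n!/k![n-k]!; k![n∸k]!∣n!)
open import Data.Nat.DivMod using (_/_; m/n*n≡m; m/n≤m; m%n<n; m≡m%n+[m/n]*n)
open import Data.Nat.ListAction using (sum)
open import Data.Nat.ListAction.Properties using (sum-++)
open import Data.Nat.Tactic.RingSolver using (solve-∀)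
open import Data.Product using (Σ; _×_; _,_)
open import Function using (id; case_of_)
open import Relation.Binary.Definitions using (tri<; tri≈; tri>)
open import Relation.Binary.PropositionalEquality using (_≡_; _≢_; refl; sym; trans; cong; cong₂; subst; module ≡-Reasoning)
open import Relation.Nullary using (yes; no)
open import Relation.Nullary.Decidable using (dec-true; dec-false)
open ≡-Reasoning

Σ< : ℕ → (ℕ → ℕ) → ℕ
Σ< zero    f = 0
Σ< (suc n) f = f 0 + Σ< n (λ i → f (suc i))

Σ-cong : ∀ n {f g : ℕ → ℕ} → (∀ i → i < n → f i ≡ g i) → Σ< n f ≡ Σ< n g
Σ-cong zero    h = refl
Σ-cong (suc n) h = cong₂ _+_ (h 0 z<s) (Σ-cong n (λ i i<n → h (suc i) (s<s i<n)))

Σ-cong′ : ∀ n {f g : ℕ → ℕ} → (∀ i → f i ≡ g i) → Σ< n f ≡ Σ< n g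
Σ-cong′ n h = Σ-cong n (λ i _ → h i)

Σ-zero : ∀ n (f : ℕ → ℕ) → (∀ i → i < n → f i ≡ 0) → Σ< n f ≡ 0
Σ-zero zero    f h = refl
Σ-zero (suc n) f h = cong₂ _+_ (h 0 z<s) (Σ-zero n _ (λ i i<n → h (suc i) (s<s i<n)))

Σ-const : ∀ n c → Σ< n (λ _ → c) ≡ n * c
Σ-const zero    c = refl
Σ-const (suc n) c = cong (c +_) (Σ-const n c)

Σ-+ : ∀ n f g → Σ< n (λ i → f i + g i) ≡ Σ< n f + Σ< n g
Σ-+ zero    f g = refl
Σ-+ (suc n) f g = begin
  (f 0 + g 0) + Σ< n (λ i → f (suc i) + g (suc i))
    ≡⟨ cong ((f 0 + g 0) +_) (Σ-+ n (λ i → f (suc i)) (λ i → g (suc i))) ⟩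
  (f 0 + g 0) + (Σ< n (λ i → f (suc i)) + Σ< n (λ i → g (suc i)))
    ≡⟨ +-assoc-swap (f 0) (g 0) _ _ ⟩
  (f 0 + Σ< n (λ i → f (suc i))) + (g 0 + Σ< n (λ i → g (suc i))) ∎
  where
  +-assoc-swap : ∀ a b c d → (a + b) + (c + d) ≡ (a + c) + (b + d)
  +-assoc-swap = solve-∀

Σ-*ˡ : ∀ n c f → Σ< n (λ i → c * f i) ≡ c * Σ< n f
Σ-*ˡ zero    c f = sym (*-zeroʳ c)
Σ-*ˡ (suc n) c f =
  trans (cong (c * f 0 +_) (Σ-*ˡ n c (λ i → f (suc i)))) (sym (*-distribˡ-+ c (f 0) _))

Σ-*ʳ : ∀ n c f → Σ< n (λ i → f i * c) ≡ Σ< n f * c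
Σ-*ʳ n c f = trans (Σ-cong′ n (λ i → *-comm (f i) c)) (trans (Σ-*ˡ n c f) (*-comm c _))

Σ-split : ∀ m k f → Σ< (m + k) f ≡ Σ< m f + Σ< k (λ i → f (m + i))
Σ-split zero    k f = refl
Σ-split (suc m) k f =
  trans (cong (f 0 +_) (Σ-split m k (λ i → f (suc i)))) (sym (+-assoc (f 0) _ _))

Σ-truncate : ∀ p n f → p ≤ n → (∀ i → p ≤ i → f i ≡ 0) → Σ< n f ≡ Σ< p f
Σ-truncate p n f p≤n tail-zero = begin
  Σ< n f                                ≡⟨ cong (λ k → Σ< k f) (sym (m+[n∸m]≡n p≤n)) ⟩
  Σ< (p + (n ∸ p)) f                    ≡⟨ Σ-split p (n ∸ p) f ⟩
  Σ< p f + Σ< (n ∸ p) (λ i → f (p + i)) ≡⟨ cong (Σ< p f +_) (Σ-zero (n ∸ p) _ (λ i _ → tail-zero (p + i) (m≤m+n p i))) ⟩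
  Σ< p f + 0                            ≡⟨ +-identityʳ _ ⟩
  Σ< p f                                ∎

Σ-swap : ∀ m n (F : ℕ → ℕ → ℕ) →
         Σ< m (λ i → Σ< n (λ j → F i j)) ≡ Σ< n (λ j → Σ< m (λ i → F i j))
Σ-swap zero    n F = sym (Σ-zero n _ (λ _ _ → refl))
Σ-swap (suc m) n F =
  trans (cong (Σ< n (F 0) +_) (Σ-swap m n (λ i j → F (suc i) j)))
        (sym (Σ-+ n (F 0) (λ j → Σ< m (λ i → F (suc i) j))))

sum-applyUpTo : ∀ (f g : ℕ → ℕ) n → sum (map f (applyUpTo g n)) ≡ Σ< n (λ i → f (g i))
sum-applyUpTo f g zero    = refl
sum-applyUpTo f g (suc n) = cong (f (g 0) +_) (sum-applyUpTo f (λ i → g (suc i)) n)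

sum-upTo : ∀ f n → sum (map f (upTo n)) ≡ Σ< n f
sum-upTo f = sum-applyUpTo f id

sum-oneTo : ∀ f n → sum (map f (oneTo n)) ≡ Σ< n (λ i → f (suc i))
sum-oneTo f n = trans (cong sum (sym (map-∘ (upTo n)))) (sum-upTo (λ i → f (suc i)) n)

sum-cong : ∀ {A : Set} {f g : A → ℕ} xs → (∀ x → f x ≡ g x) → sum (map f xs) ≡ sum (map g xs)
sum-cong xs h = cong sum (map-cong h xs)

sum-map-map : ∀ {A B : Set} (f : B → ℕ) (g : A → B) xs →
              sum (map f (map g xs)) ≡ sum (map (λ x → f (g x)) xs)
sum-map-map f g xs = cong sum (sym (map-∘ xs))

sum-concatMap : ∀ {A B : Set} (f : B → ℕ) (g : A → List B) xs →
                sum (map f (concatMap g xs)) ≡ sum (map (λ x → sum (map f (g x))) xs)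
sum-concatMap f g []       = refl
sum-concatMap f g (x ∷ xs) =
  trans (cong sum (map-++ f (g x) (concatMap g xs)))
        (trans (sum-++ (map f (g x)) _) (cong (_ +_) (sum-concatMap f g xs)))

sum-*ˡ : ∀ {A : Set} c (f : A → ℕ) xs → sum (map (λ x → c * f x) xs) ≡ c * sum (map f xs)
sum-*ˡ c f []       = sym (*-zeroʳ c)
sum-*ˡ c f (x ∷ xs) = trans (cong (c * f x +_) (sum-*ˡ c f xs)) (sym (*-distribˡ-+ c (f x) _))

sum-if : ∀ {A : Set} (b : Bool) (f : A → ℕ) xs →
         sum (map (λ x → if b then f x else 0) xs) ≡ (if b then sum (map f xs) else 0)
sum-if true  f xs       = refl
sum-if false f []       = refl
sum-if false f (x ∷ xs) = sum-if false f xs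

indicator : Bool → ℕ
indicator b = if b then 1 else 0

≤ᵇ-true : ∀ {m n} → m ≤ n → (m ≤ᵇ n) ≡ true
≤ᵇ-true {m} {n} = dec-true (m ≤? n)

≤ᵇ-false : ∀ {m n} → n < m → (m ≤ᵇ n) ≡ false
≤ᵇ-false {m} {n} n<m = dec-false (m ≤? n) (<⇒≱ n<m)

≤ᵇ≡true⇒≤ : ∀ {m n} → (m ≤ᵇ n) ≡ true → m ≤ n
≤ᵇ≡true⇒≤ {m} {n} eq = ≤ᵇ⇒≤ m n (subst T (sym eq) _)

≤ᵇ≡false⇒> : ∀ {m n} → (m ≤ᵇ n) ≡ false → n < m
≤ᵇ≡false⇒> {m} {n} eq = ≰⇒> (λ m≤n → case trans (sym (≤ᵇ-true m≤n)) eq of λ ())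

<ᵇ-true : ∀ {m n} → m < n → (m <ᵇ n) ≡ true
<ᵇ-true {m} {n} = dec-true (m <? n)

<ᵇ-false : ∀ {m n} → n ≤ m → (m <ᵇ n) ≡ false
<ᵇ-false {m} {n} n≤m = dec-false (m <? n) (≤⇒≯ n≤m)

<ᵇ≡true⇒< : ∀ {m n} → (m <ᵇ n) ≡ true → m < n
<ᵇ≡true⇒< {m} {n} eq = <ᵇ⇒< m n (subst T (sym eq) _)

≡ᵇ-true : ∀ {m n} → m ≡ n → (m ≡ᵇ n) ≡ true
≡ᵇ-true {m} {n} = dec-true (m ≟ n)

≡ᵇ-false : ∀ {m n} → m ≢ n → (m ≡ᵇ n) ≡ false
≡ᵇ-false {m} {n} = dec-false (m ≟ n)

rising : ℕ → ℕ → ℕ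
rising y zero    = 1
rising y (suc e) = suc y * rising (suc y) e

rising-snoc : ∀ y e → rising y (suc e) ≡ rising y e * suc (y + e)
rising-snoc y zero    rewrite +-identityʳ y = *-comm (suc y) 1
rising-snoc y (suc e) rewrite rising-snoc (suc y) e | +-suc y e =
  sym (*-assoc (suc y) (rising (suc y) e) (suc (suc (y + e))))

rising-pascal : ∀ y e → rising (suc y) (suc e) ≡ rising y (suc e) + suc e * rising (suc y) e
rising-pascal y e rewrite rising-snoc (suc y) e = distribute y e (rising (suc y) e)
  where
  distribute : ∀ y e X → X * suc (suc y + e) ≡ suc y * X + suc e * X
  distribute = solve-∀

rising-factorial : ∀ j k → rising j k * j ! ≡ (j + k) !
rising-factorial j zero    rewrite +-identityʳ j = +-identityʳ (j !)
rising-factorial j (suc k) rewrite rising-snoc j k | +-suc j k = begin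
  rising j k * suc (j + k) * j ! ≡⟨ rearrange (rising j k) (suc (j + k)) (j !) ⟩
  suc (j + k) * (rising j k * j !) ≡⟨ cong (suc (j + k) *_) (rising-factorial j k) ⟩
  suc (j + k) * (j + k) ! ∎
  where
  rearrange : ∀ x y z → x * y * z ≡ y * (x * z)
  rearrange = solve-∀

risingSum : ℕ → ℕ → ℕ
risingSum j e = Σ< (suc j) (λ i → rising (j ∸ i) e)

rising-hockey-stick : ∀ m e → suc e * risingSum m e ≡ rising m (suc e)
rising-hockey-stick zero e rewrite rising-snoc 0 e = base (rising 0 e) e
  where
  base : ∀ X e → suc e * (X + 0) ≡ X * suc e
  base = solve-∀
rising-hockey-stick (suc m) e = begin
  suc e * (rising (suc m) e + risingSum m e)            ≡⟨ *-distribˡ-+ (suc e) (rising (suc m) e) _ ⟩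
  suc e * rising (suc m) e + suc e * risingSum m e      ≡⟨ cong (suc e * rising (suc m) e +_) (rising-hockey-stick m e) ⟩
  suc e * rising (suc m) e + rising m (suc e)           ≡⟨ +-comm (suc e * rising (suc m) e) _ ⟩
  rising m (suc e) + suc e * rising (suc m) e           ≡⟨ sym (rising-pascal m e) ⟩
  rising (suc m) (suc e)                                ∎

-- It counts the ways to
-- get from a kernel position of length j to the next kernel position, reached at
-- length j + e + 2 (see kernelCompletions-kernel).
weightedRisingSum : ℕ → ℕ → ℕ
weightedRisingSum j e = Σ< (suc j) (λ i → suc i * rising (j ∸ i) e)

-- Each of the i+1 copies of rising (j-i) e moves one index up when j grows.
weightedRisingSum-step : ∀ j e →
  weightedRisingSum (suc j) e ≡ weightedRisingSum j e + risingSum (suc j) e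
weightedRisingSum-step j e = begin
  1 * rising (suc j) e + Σ< (suc j) (λ i → rising (j ∸ i) e + suc i * rising (j ∸ i) e)
    ≡⟨ cong (1 * rising (suc j) e +_) (Σ-+ (suc j) (λ i → rising (j ∸ i) e) (λ i → suc i * rising (j ∸ i) e)) ⟩
  1 * rising (suc j) e + (risingSum j e + weightedRisingSum j e)
    ≡⟨ rearrange (rising (suc j) e) (risingSum j e) (weightedRisingSum j e) ⟩
  weightedRisingSum j e + (rising (suc j) e + risingSum j e) ∎
  where
  rearrange : ∀ x y z → 1 * x + (y + z) ≡ z + (x + y)
  rearrange = solve-∀

weightedRisingSum-closed : ∀ j e →
  suc e * suc (suc e) * weightedRisingSum j e ≡ rising j (suc (suc e))
weightedRisingSum-closed zero e rewrite rising-snoc 0 (suc e) | rising-snoc 0 e =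
  base (rising 0 e) e
  where
  base : ∀ X e → suc e * suc (suc e) * (1 * X + 0) ≡ X * suc e * suc (suc e)
  base = solve-∀
weightedRisingSum-closed (suc j) e = begin
  e₁ * e₂ * weightedRisingSum (suc j) e
    ≡⟨ cong (e₁ * e₂ *_) (weightedRisingSum-step j e) ⟩
  e₁ * e₂ * (weightedRisingSum j e + risingSum (suc j) e)
    ≡⟨ distribute e₁ e₂ (weightedRisingSum j e) (risingSum (suc j) e) ⟩
  e₁ * e₂ * weightedRisingSum j e + e₂ * (e₁ * risingSum (suc j) e)
    ≡⟨ cong₂ _+_ (weightedRisingSum-closed j e) (cong (e₂ *_) (rising-hockey-stick (suc j) e)) ⟩
  rising j e₂ + e₂ * rising (suc j) e₁
    ≡⟨ sym (rising-pascal j e₁) ⟩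
  rising (suc j) e₂ ∎
  where
  e₁ e₂ : ℕ
  e₁ = suc e
  e₂ = suc (suc e)
  distribute : ∀ p q x y → p * q * (x + y) ≡ p * q * x + q * (p * y)
  distribute = solve-∀

binomial-factorial : ∀ n k → k ≤ n → (n C k) * (k ! * (n ∸ k) !) ≡ n !
binomial-factorial n k k≤n =
  trans (cong (_* (k ! * (n ∸ k) !)) (nCk≡n!/k![n-k]! k≤n))
        (m/n*n≡m {{_!*_!≢0 k (n ∸ k)}} (k![n∸k]!∣n! k≤n))

gapWeight : ℕ → ℕ → ℕ
gapWeight i j = ((j ∸ i ∸ 2) !) * (j C i)

weightedRisingSum≡gapWeight : ∀ j e → weightedRisingSum j e ≡ gapWeight j (j + suc (suc e))
weightedRisingSum≡gapWeight j e = begin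
  weightedRisingSum j e ≡⟨ *-cancelˡ-≡ _ _ (e₁ * e₂) scaled ⟩
  e ! * (b C j)         ≡⟨ cong (λ g → (g ∸ 2) ! * (b C j)) (sym b∸j) ⟩
  gapWeight j b         ∎
  where
  e₁ e₂ b : ℕ
  e₁ = suc e
  e₂ = suc (suc e)
  b  = j + e₂
  b∸j : b ∸ j ≡ e₂
  b∸j = m+n∸m≡n j e₂
  -- multiplied by (e+1)(e+2) · j!, both sides equal b!
  binomial-side : e₁ * e₂ * (e ! * (b C j)) * j ! ≡ b !
  binomial-side = begin
    e₁ * e₂ * (e ! * (b C j)) * j !  ≡⟨ rearrange e (e !) (b C j) (j !) ⟩
    (b C j) * (j ! * e₂ !)           ≡⟨ subst (λ z → (b C j) * (j ! * z !) ≡ b !) b∸j (binomial-factorial b j (m≤m+n j e₂)) ⟩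
    b !                              ∎
    where
    rearrange : ∀ e f C J → suc e * suc (suc e) * (f * C) * J ≡ C * (J * (suc (suc e) * (suc e * f)))
    rearrange = solve-∀
  scaled : e₁ * e₂ * weightedRisingSum j e ≡ e₁ * e₂ * (e ! * (b C j))
  scaled = trans (weightedRisingSum-closed j e)
                 (*-cancelʳ-≡ _ _ (j !) {{j !≢0}} (trans (rising-factorial j e₂) (sym binomial-side)))

endsChain : ℕ → List ℕ → Bool
endsChain n c = lastIs n c ∧ pairsOk (λ i j → (i + 2) ≤ᵇ j) c

chainTerm : ℕ → List ℕ → ℕ
chainTerm n c = if endsChain n c then weight c else 0

chainWeight : ℕ → ℕ → ℕ → ℕ
chainWeight n zero    a = indicator (a ≡ᵇ n)
chainWeight n (suc l) a =
  sum (map (λ b → if (a + 2) ≤ᵇ b then gapWeight a b * chainWeight n l b else 0) (oneTo n))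

chainTerm-cons : ∀ n a b t →
  chainTerm n (a ∷ b ∷ t) ≡ (if (a + 2) ≤ᵇ b then gapWeight a b * chainTerm n (b ∷ t) else 0)
chainTerm-cons n a b t with lastIs n (b ∷ t) | (a + 2) ≤ᵇ b | pairsOk (λ i j → (i + 2) ≤ᵇ j) (b ∷ t)
... | true  | true  | true  = refl
... | true  | true  | false = sym (*-zeroʳ (gapWeight a b))
... | false | true  | _     = sym (*-zeroʳ (gapWeight a b))
... | true  | false | _     = refl
... | false | false | _     = refl

tuples-chainWeight : ∀ n l a →
  sum (map (λ t → chainTerm n (a ∷ t)) (tuples l (oneTo n))) ≡ chainWeight n l a
tuples-chainWeight n zero a with a ≡ᵇ n
... | true  = refl
... | false = refl
tuples-chainWeight n (suc l) a = begin
  sum (map (λ t → chainTerm n (a ∷ t)) (concatMap (λ b → map (b ∷_) ts) (oneTo n)))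
    ≡⟨ sum-concatMap (λ t → chainTerm n (a ∷ t)) (λ b → map (b ∷_) ts) (oneTo n) ⟩
  sum (map (λ b → sum (map (λ t → chainTerm n (a ∷ t)) (map (b ∷_) ts))) (oneTo n))
    ≡⟨ sum-cong (oneTo n) first-step ⟩
  chainWeight n (suc l) a ∎
  where
  ts : List (List ℕ)
  ts = tuples l (oneTo n)
  first-step : ∀ b → sum (map (λ t → chainTerm n (a ∷ t)) (map (b ∷_) ts))
                     ≡ (if (a + 2) ≤ᵇ b then gapWeight a b * chainWeight n l b else 0)
  first-step b = begin
    sum (map (λ t → chainTerm n (a ∷ t)) (map (b ∷_) ts))
      ≡⟨ sum-map-map (λ t → chainTerm n (a ∷ t)) (b ∷_) ts ⟩
    sum (map (λ t → chainTerm n (a ∷ b ∷ t)) ts)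
      ≡⟨ sum-cong ts (chainTerm-cons n a b) ⟩
    sum (map (λ t → if (a + 2) ≤ᵇ b then gapWeight a b * chainTerm n (b ∷ t) else 0) ts)
      ≡⟨ sum-if ((a + 2) ≤ᵇ b) _ ts ⟩
    (if (a + 2) ≤ᵇ b then sum (map (λ t → gapWeight a b * chainTerm n (b ∷ t)) ts) else 0)
      ≡⟨ cong (λ s → if (a + 2) ≤ᵇ b then s else 0)
              (trans (sum-*ˡ (gapWeight a b) _ ts) (cong (gapWeight a b *_) (tuples-chainWeight n l b))) ⟩
    (if (a + 2) ≤ᵇ b then gapWeight a b * chainWeight n l b else 0) ∎

if-∧ : ∀ b c (w : ℕ) → (if b ∧ c then w else 0) ≡ (if b then (if c then w else 0) else 0)
if-∧ true  c w = refl
if-∧ false c w = refl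

sum-oneTo-at-1 : ∀ m (f : ℕ → ℕ) → sum (map (λ x → if x ≡ᵇ 1 then f x else 0) (oneTo (suc m))) ≡ f 1
sum-oneTo-at-1 m f = begin
  sum (map (λ x → if x ≡ᵇ 1 then f x else 0) (oneTo (suc m)))
    ≡⟨ sum-oneTo _ (suc m) ⟩
  f 1 + Σ< m (λ i → if suc (suc i) ≡ᵇ 1 then f (suc (suc i)) else 0)
    ≡⟨ cong (f 1 +_) (Σ-zero m _ (λ _ _ → refl)) ⟩
  f 1 + 0
    ≡⟨ +-identityʳ (f 1) ⟩
  f 1 ∎

innerSum≡chainWeight : ∀ m k → innerSum (suc m) k ≡ chainWeight (suc m) (suc k) 1
innerSum≡chainWeight m k rewrite +-comm k 2 = begin
  sum (map (λ c → if isChain n c then weight c else 0) (concatMap (λ x → map (x ∷_) ts) (oneTo n)))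
    ≡⟨ sum-concatMap _ (λ x → map (x ∷_) ts) (oneTo n) ⟩
  sum (map (λ x → sum (map (λ c → if isChain n c then weight c else 0) (map (x ∷_) ts))) (oneTo n))
    ≡⟨ sum-cong (oneTo n) first-entry ⟩
  sum (map (λ x → if x ≡ᵇ 1 then chainWeight n (suc k) x else 0) (oneTo n))
    ≡⟨ sum-oneTo-at-1 m (chainWeight n (suc k)) ⟩
  chainWeight n (suc k) 1 ∎
  where
  n : ℕ
  n = suc m
  ts : List (List ℕ)
  ts = tuples (suc k) (oneTo n)
  first-entry : ∀ x → sum (map (λ c → if isChain n c then weight c else 0) (map (x ∷_) ts))
                      ≡ (if x ≡ᵇ 1 then chainWeight n (suc k) x else 0)
  first-entry x = begin
    sum (map (λ c → if isChain n c then weight c else 0) (map (x ∷_) ts))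
      ≡⟨ sum-map-map _ (x ∷_) ts ⟩
    sum (map (λ t → if (x ≡ᵇ 1) ∧ endsChain n (x ∷ t) then weight (x ∷ t) else 0) ts)
      ≡⟨ sum-cong ts (λ t → if-∧ (x ≡ᵇ 1) (endsChain n (x ∷ t)) (weight (x ∷ t))) ⟩
    sum (map (λ t → if x ≡ᵇ 1 then chainTerm n (x ∷ t) else 0) ts)
      ≡⟨ sum-if (x ≡ᵇ 1) _ ts ⟩
    (if x ≡ᵇ 1 then sum (map (λ t → chainTerm n (x ∷ t)) ts) else 0)
      ≡⟨ cong (λ s → if x ≡ᵇ 1 then s else 0) (tuples-chainWeight n (suc k) x) ⟩
    (if x ≡ᵇ 1 then chainWeight n (suc k) x else 0) ∎

-- A chain from a with l steps of size ≥ 2 ends at least at a + 2l.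
chainWeight-long : ∀ n l a → n < a + (l + l) → chainWeight n l a ≡ 0
chainWeight-long n zero a n<a+0 =
  cong indicator (≡ᵇ-false (λ a≡n → <-irrefl (trans (sym a≡n) (sym (+-identityʳ a))) n<a+0))
chainWeight-long n (suc l) a n<a+2l = trans (sum-oneTo _ n) (Σ-zero n _ (λ i _ → term-zero (suc i)))
  where
  term-zero : ∀ b → (if (a + 2) ≤ᵇ b then gapWeight a b * chainWeight n l b else 0) ≡ 0
  term-zero b with (a + 2) ≤ᵇ b in gap
  ... | false = refl
  ... | true  = trans (cong (gapWeight a b *_) (chainWeight-long n l b n<b+2l)) (*-zeroʳ (gapWeight a b))
    where
    n<b+2l : n < b + (l + l)
    n<b+2l = <-≤-trans n<a+2l (≤-trans (≤-reflexive (regroup a l)) (+-monoˡ-≤ (l + l) (≤ᵇ≡true⇒≤ {a + 2} {b} gap)))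
      where
      regroup : ∀ a l → a + (suc l + suc l) ≡ a + 2 + (l + l)
      regroup = solve-∀

two-later : ∀ j e → suc (suc j + e) ≡ j + suc (suc e)
two-later = solve-∀

chainWeight-step : ∀ n j d l → n ≡ suc (j + d) →
  chainWeight n (suc l) j ≡ Σ< d (λ e → gapWeight j (j + suc (suc e)) * chainWeight n l (j + suc (suc e)))
chainWeight-step n j d l refl = begin
  chainWeight n (suc l) j
    ≡⟨ sum-oneTo term (suc j + d) ⟩
  Σ< (suc j + d) (λ i → term (suc i))
    ≡⟨ Σ-split (suc j) d (λ i → term (suc i)) ⟩
  Σ< (suc j) (λ i → term (suc i)) + Σ< d (λ e → term (suc (suc j + e)))
    ≡⟨ cong₂ _+_ (Σ-zero (suc j) _ too-close) (Σ-cong′ d far-enough) ⟩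
  Σ< d (λ e → gapWeight j (j + suc (suc e)) * chainWeight n l (j + suc (suc e))) ∎
  where
  term : ℕ → ℕ
  term b = if (j + 2) ≤ᵇ b then gapWeight j b * chainWeight (suc (j + d)) l b else 0
  too-close : ∀ i → i < suc j → term (suc i) ≡ 0
  too-close i i<1+j rewrite ≤ᵇ-false {j + 2} {suc i} (≤-trans (s≤s i<1+j) (≤-reflexive (+-comm 2 j))) = refl
  far-enough : ∀ e → term (suc (suc j + e)) ≡ gapWeight j (j + suc (suc e)) * chainWeight n l (j + suc (suc e))
  far-enough e rewrite two-later j e
                     | ≤ᵇ-true {j + 2} {j + suc (suc e)} (+-monoʳ-≤ j (s≤s (s≤s z≤n))) = refl

winningMove : List ℕ → ℕ → Bool
winningMove w m = validMove m w ∧ isKernel (take m w)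

pivot : List ℕ → ℕ → ℕ
pivot w m with drop m w
... | []    = 0
... | a ∷ _ = a

validMove⇒< : ∀ m w → validMove m w ≡ true → m < length w
validMove⇒< m w valid with 1 ≤ᵇ m | m <ᵇ length w in lt
... | true  | true  = <ᵇ≡true⇒< {m} {length w} lt
validMove⇒< m w () | true  | false
validMove⇒< m w () | false | _

validMove-shortens : ∀ m w → validMove m w ≡ true → length (take m w) < length w
validMove-shortens m w valid =
  ≤-<-trans (≤-trans (≤-reflexive (length-take m w)) (m⊓n≤m m (length w))) (validMove⇒< m w valid)

allB-cong : ∀ {A : Set} {p q : A → Bool} xs → (∀ x → p x ≡ q x) → allB p xs ≡ allB q xs
allB-cong []       h = refl
allB-cong (x ∷ xs) h = cong₂ _∧_ (h x) (allB-cong xs h)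

allB-true : ∀ {A : Set} (xs : List A) → allB (λ _ → true) xs ≡ true
allB-true []       = refl
allB-true (x ∷ xs) = allB-true xs

allB-applyUpTo-false : ∀ (p : ℕ → Bool) g n i → i < n → p (g i) ≡ false → allB p (applyUpTo g n) ≡ false
allB-applyUpTo-false p g (suc n) zero    _         pgi rewrite pgi = refl
allB-applyUpTo-false p g (suc n) (suc i) (s≤s i<n) pgi
  rewrite allB-applyUpTo-false p (λ k → g (suc k)) n i i<n pgi = ∧-zeroʳ (p (g 0))

kernelF-fuel : ∀ f g w → length w ≤ f → length w ≤ g → kernelF f w ≡ kernelF g w
kernelF-fuel zero    zero    w       _ _ = refl
kernelF-fuel zero    (suc g) []      _ _ = refl
kernelF-fuel (suc f) zero    []      _ _ = refl
kernelF-fuel (suc f) (suc g) w |w|≤f |w|≤g = allB-cong (upTo (length w)) same-answer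
  where
  same-answer : ∀ m → not (validMove m w ∧ kernelF f (take m w)) ≡ not (validMove m w ∧ kernelF g (take m w))
  same-answer m with validMove m w in valid
  ... | false = refl
  ... | true  = cong not (kernelF-fuel f g (take m w)
                            (s≤s⁻¹ (<-≤-trans (validMove-shortens m w valid) |w|≤f))
                            (s≤s⁻¹ (<-≤-trans (validMove-shortens m w valid) |w|≤g)))

isKernel-noWinningMove : ∀ w → isKernel w ≡ allB (λ m → not (winningMove w m)) (upTo (length w))
isKernel-noWinningMove []      = refl
isKernel-noWinningMove (y ∷ r) = allB-cong (upTo (suc (length r))) same-answer
  where
  w : List ℕ
  w = y ∷ r
  same-answer : ∀ m → not (validMove m w ∧ kernelF (length r) (take m w)) ≡ not (winningMove w m)
  same-answer m with validMove m w in valid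
  ... | false = refl
  ... | true  = cong not (kernelF-fuel (length r) (length (take m w)) (take m w)
                            (s≤s⁻¹ (validMove-shortens m w valid)) ≤-refl)

length-∷ʳ : ∀ (w : List ℕ) x → length (w ∷ʳ x) ≡ suc (length w)
length-∷ʳ w x = trans (length-++ w) (+-comm (length w) 1)

take-++ : ∀ m (w v : List ℕ) → m ≤ length w → take m (w ++ v) ≡ take m w
take-++ zero    w       v _         = refl
take-++ (suc m) (y ∷ w) v (s≤s m≤w) = cong (y ∷_) (take-++ m w v m≤w)

drop-++ : ∀ m (w v : List ℕ) → m ≤ length w → drop m (w ++ v) ≡ drop m w ++ v
drop-++ zero    w       v _         = refl
drop-++ (suc m) (y ∷ w) v (s≤s m≤w) = drop-++ m w v m≤w

allB-∷ʳ : ∀ {A : Set} (p : A → Bool) xs x → allB p (xs ∷ʳ x) ≡ allB p xs ∧ p x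
allB-∷ʳ p []       x = ∧-identityʳ (p x)
allB-∷ʳ p (y ∷ xs) x = trans (cong (p y ∧_) (allB-∷ʳ p xs x)) (sym (∧-assoc (p y) _ (p x)))

pivot-∷ʳ : ∀ m (w : List ℕ) x → m < length w → pivot (w ∷ʳ x) m ≡ pivot w m
pivot-∷ʳ zero    (a ∷ r) x _         = refl
pivot-∷ʳ (suc m) (y ∷ w) x (s≤s m<w) = pivot-∷ʳ m w x m<w

tailAbove-∷ʳ : ∀ m (w : List ℕ) x → m < length w →
  tailAbove (drop m (w ∷ʳ x)) ≡ tailAbove (drop m w) ∧ (pivot w m <ᵇ x)
tailAbove-∷ʳ zero    (a ∷ r) x _       = allB-∷ʳ (a <ᵇ_) r x
tailAbove-∷ʳ (suc m) (y ∷ w) x (s≤s m<w) = tailAbove-∷ʳ m w x m<w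

∧-regroup : ∀ a b c k → ((a ∧ (true ∧ (b ∧ c))) ∧ k) ≡ ((a ∧ (true ∧ b)) ∧ k) ∧ c
∧-regroup true  true  true  k     = sym (∧-identityʳ k)
∧-regroup true  true  false true  = refl
∧-regroup true  true  false false = refl
∧-regroup true  false c     k     = refl
∧-regroup false b     c     k     = refl

winningMove-∷ʳ-old : ∀ w x m → m < length w →
  winningMove (w ∷ʳ x) m ≡ winningMove w m ∧ (pivot w m <ᵇ x)
winningMove-∷ʳ-old w x m m<w
  rewrite take-++ m w [ x ] (<⇒≤ m<w) | tailAbove-∷ʳ m w x m<w | length-∷ʳ w x
        | <ᵇ-true {m} {suc (length w)} (m≤n⇒m≤1+n m<w) | <ᵇ-true m<w =
  ∧-regroup (1 ≤ᵇ m) (tailAbove (drop m w)) (pivot w m <ᵇ x) (isKernel (take m w))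

winningMove-∷ʳ-new : ∀ w x → winningMove (w ∷ʳ x) (length w) ≡ (1 ≤ᵇ length w) ∧ isKernel w
winningMove-∷ʳ-new w x
  rewrite take-++ (length w) w [ x ] ≤-refl | drop-++ (length w) w [ x ] ≤-refl | length-∷ʳ w x
        | <ᵇ-true {length w} {suc (length w)} ≤-refl
        | drop-all (length w) w ≤-refl | take-all (length w) w ≤-refl
        | ∧-identityʳ (1 ≤ᵇ length w) = refl

winningMove-∷ʳ-beyond : ∀ w x m → length w < m → winningMove (w ∷ʳ x) m ≡ false
winningMove-∷ʳ-beyond w x m w<m
  rewrite length-∷ʳ w x | <ᵇ-false {m} {suc (length w)} w<m | ∧-zeroʳ (1 ≤ᵇ m) = refl

-- The automaton recognising kernel positions.  A non-empty position is either a
-- kernel position or has exactly one winning move; in that case we remember its pivot.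
data Phase : Set where
  start     : Phase
  kernel    : Phase
  nonKernel : ℕ → Phase

advance : Phase → ℕ → Phase
advance start         x = kernel
advance kernel        x = nonKernel x
advance (nonKernel p) x = if x ≤ᵇ p then kernel else nonKernel p

phaseOf : List ℕ → Phase
phaseOf = foldl advance start

isKernelPhase : Phase → Bool
isKernelPhase start         = true
isKernelPhase kernel        = true
isKernelPhase (nonKernel _) = false

Describes : List ℕ → Phase → Set
Describes w start         = w ≡ []
Describes w kernel        = 0 < length w × (∀ m → winningMove w m ≡ false)
Describes w (nonKernel p) =
  Σ ℕ λ m₀ → m₀ < length w × pivot w m₀ ≡ p × (∀ m → winningMove w m ≡ (m ≡ᵇ m₀))

describes-isKernel : ∀ w s → Describes w s → isKernel w ≡ isKernelPhase s
describes-isKernel w start refl = refl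
describes-isKernel w kernel (_ , losing) = begin
  isKernel w                                              ≡⟨ isKernel-noWinningMove w ⟩
  allB (λ m → not (winningMove w m)) (upTo (length w))    ≡⟨ allB-cong (upTo (length w)) (λ m → cong not (losing m)) ⟩
  allB (λ _ → true) (upTo (length w))                     ≡⟨ allB-true (upTo (length w)) ⟩
  true                                                    ∎
describes-isKernel w (nonKernel p) (m₀ , m₀<w , _ , winning) =
  trans (isKernel-noWinningMove w)
        (allB-applyUpTo-false _ id (length w) m₀ m₀<w (cong not (trans (winning m₀) (≡ᵇ-true {m₀} refl))))

advance-start : ∀ x → Describes [ x ] kernel
advance-start x = z<s , no-winning
  where
  no-winning : ∀ m → winningMove [ x ] m ≡ false
  no-winning zero    = refl
  no-winning (suc m) = winningMove-∷ʳ-beyond [] x (suc m) z<s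

advance-kernel : ∀ w x → Describes w kernel → Describes (w ∷ʳ x) (nonKernel x)
advance-kernel w x (0<w , losing) =
  length w , ≤-reflexive (sym (length-∷ʳ w x)) , pivot-new , winning
  where
  pivot-new : pivot (w ∷ʳ x) (length w) ≡ x
  pivot-new rewrite drop-++ (length w) w [ x ] ≤-refl | drop-all (length w) w ≤-refl = refl
  w-kernel : isKernel w ≡ true
  w-kernel = describes-isKernel w kernel (0<w , losing)
  winning : ∀ m → winningMove (w ∷ʳ x) m ≡ (m ≡ᵇ length w)
  winning m with <-cmp m (length w)
  ... | tri< m<w m≢w _ rewrite winningMove-∷ʳ-old w x m m<w | losing m | ≡ᵇ-false m≢w = refl
  ... | tri≈ _ refl _  rewrite winningMove-∷ʳ-new w x | w-kernel | ≤ᵇ-true {1} {length w} 0<w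
                             | ≡ᵇ-true {length w} refl = refl
  ... | tri> _ m≢w w<m rewrite winningMove-∷ʳ-beyond w x m w<m | ≡ᵇ-false m≢w = refl

-- A letter at most the pivot destroys the only winning move.
advance-nonKernel-below : ∀ w x p → x ≤ p → Describes w (nonKernel p) → Describes (w ∷ʳ x) kernel
advance-nonKernel-below w x p x≤p (m₀ , m₀<w , pivot≡p , winning) =
  ≤-trans z<s (≤-reflexive (sym (length-∷ʳ w x))) , losing
  where
  w-nonKernel : isKernel w ≡ false
  w-nonKernel = describes-isKernel w (nonKernel p) (m₀ , m₀<w , pivot≡p , winning)
  losing : ∀ m → winningMove (w ∷ʳ x) m ≡ false
  losing m with <-cmp m (length w)
  ... | tri< m<w _ _ rewrite winningMove-∷ʳ-old w x m m<w | winning m with m ≟ m₀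
  ...   | yes refl rewrite ≡ᵇ-true {m} refl | pivot≡p | <ᵇ-false {p} {x} x≤p = refl
  ...   | no m≢m₀  rewrite ≡ᵇ-false m≢m₀ = refl
  losing m | tri≈ _ refl _ rewrite winningMove-∷ʳ-new w x | w-nonKernel = ∧-zeroʳ (1 ≤ᵇ length w)
  losing m | tri> _ _ w<m = winningMove-∷ʳ-beyond w x m w<m

-- A letter above the pivot keeps the winning move winning, and creates no other.
advance-nonKernel-above : ∀ w x p → p < x → Describes w (nonKernel p) → Describes (w ∷ʳ x) (nonKernel p)
advance-nonKernel-above w x p p<x (m₀ , m₀<w , pivot≡p , winning) =
  m₀ , ≤-trans (m≤n⇒m≤1+n m₀<w) (≤-reflexive (sym (length-∷ʳ w x))) , pivot-kept , winning′
  where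
  w-nonKernel : isKernel w ≡ false
  w-nonKernel = describes-isKernel w (nonKernel p) (m₀ , m₀<w , pivot≡p , winning)
  pivot-kept : pivot (w ∷ʳ x) m₀ ≡ p
  pivot-kept = trans (pivot-∷ʳ m₀ w x m₀<w) pivot≡p
  winning′ : ∀ m → winningMove (w ∷ʳ x) m ≡ (m ≡ᵇ m₀)
  winning′ m with <-cmp m (length w)
  ... | tri< m<w _ _ rewrite winningMove-∷ʳ-old w x m m<w | winning m with m ≟ m₀
  ...   | yes refl rewrite ≡ᵇ-true {m} refl | pivot≡p | <ᵇ-true p<x = refl
  ...   | no m≢m₀  rewrite ≡ᵇ-false m≢m₀ = refl
  winning′ m | tri≈ _ refl _ rewrite winningMove-∷ʳ-new w x | w-nonKernel | ∧-zeroʳ (1 ≤ᵇ length w) =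
    sym (≡ᵇ-false (λ w≡m₀ → <-irrefl (sym w≡m₀) m₀<w))
  winning′ m | tri> _ _ w<m rewrite winningMove-∷ʳ-beyond w x m w<m =
    sym (≡ᵇ-false (λ m≡m₀ → <-irrefl (sym m≡m₀) (<-trans m₀<w w<m)))

describes-advance : ∀ w s x → Describes w s → Describes (w ∷ʳ x) (advance s x)
describes-advance w start         x refl = advance-start x
describes-advance w kernel        x inv  = advance-kernel w x inv
describes-advance w (nonKernel p) x inv with x ≤ᵇ p in x≤ᵇp
... | true  = advance-nonKernel-below w x p (≤ᵇ≡true⇒≤ x≤ᵇp) inv
... | false = advance-nonKernel-above w x p (≤ᵇ≡false⇒> x≤ᵇp) inv

describes-foldl : ∀ v s w → Describes v s → Describes (v ++ w) (foldl advance s w)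
describes-foldl v s []      inv = subst (λ u → Describes u s) (sym (++-identityʳ v)) inv
describes-foldl v s (x ∷ w) inv =
  subst (λ u → Describes u (foldl advance (advance s x) w)) (++-assoc v [ x ] w)
        (describes-foldl (v ∷ʳ x) (advance s x) w (describes-advance v s x inv))

isKernel-phaseOf : ∀ w → isKernel w ≡ isKernelPhase (phaseOf w)
isKernel-phaseOf w = describes-isKernel w (phaseOf w) (describes-foldl [] start w refl)

-- kernelCompletions d j s counts the ways to extend a position of length j in
-- phase s by d letters (the letter at position i ranging over 1, …, i) so that the
-- result is a kernel position.  It depends on the position only through its phase.
kernelCompletions : ℕ → ℕ → Phase → ℕ
kernelCompletions zero    j s = indicator (isKernelPhase s)
kernelCompletions (suc d) j s =
  sum (map (λ x → kernelCompletions d (suc j) (advance s x)) (oneTo (suc j)))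

sum-positions-suc : ∀ (f : List ℕ → ℕ) n → sum (map f (positions (suc n))) ≡
  sum (map (λ w → sum (map (λ x → f (w ∷ʳ x)) (oneTo (suc n)))) (positions n))
sum-positions-suc f n =
  trans (sum-concatMap f (λ w → map (w ∷ʳ_) (oneTo (suc n))) (positions n))
        (sum-cong (positions n) (λ w → sum-map-map f (w ∷ʳ_) (oneTo (suc n))))

phaseOf-∷ʳ : ∀ w x → phaseOf (w ∷ʳ x) ≡ advance (phaseOf w) x
phaseOf-∷ʳ w x = foldl-∷ʳ advance start x w

kernelCompletions-correct : ∀ d j →
  sum (map (λ w → kernelCompletions d j (phaseOf w)) (positions j))
  ≡ sum (map (λ w → indicator (isKernelPhase (phaseOf w))) (positions (d + j)))
kernelCompletions-correct zero    j = refl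
kernelCompletions-correct (suc d) j = begin
  sum (map (λ w → kernelCompletions (suc d) j (phaseOf w)) (positions j))
    ≡⟨ sum-cong (positions j) (λ w → sum-cong (oneTo (suc j)) (λ x → cong (kernelCompletions d (suc j)) (sym (phaseOf-∷ʳ w x)))) ⟩
  sum (map (λ w → sum (map (λ x → kernelCompletions d (suc j) (phaseOf (w ∷ʳ x))) (oneTo (suc j)))) (positions j))
    ≡⟨ sym (sum-positions-suc (λ w → kernelCompletions d (suc j) (phaseOf w)) j) ⟩
  sum (map (λ w → kernelCompletions d (suc j) (phaseOf w)) (positions (suc j)))
    ≡⟨ kernelCompletions-correct d (suc j) ⟩
  sum (map (λ w → indicator (isKernelPhase (phaseOf w))) (positions (d + suc j)))
    ≡⟨ cong (λ k → sum (map (λ w → indicator (isKernelPhase (phaseOf w))) (positions k))) (+-suc d j) ⟩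
  sum (map (λ w → indicator (isKernelPhase (phaseOf w))) (positions (suc d + j))) ∎

κ≡kernelCompletions : ∀ n → κ n ≡ kernelCompletions n 0 start
κ≡kernelCompletions n = begin
  κ n
    ≡⟨ sum-cong (positions n) (λ w → cong indicator (isKernel-phaseOf w)) ⟩
  sum (map (λ w → indicator (isKernelPhase (phaseOf w))) (positions n))
    ≡⟨ cong (λ k → sum (map (λ w → indicator (isKernelPhase (phaseOf w))) (positions k))) (sym (+-identityʳ n)) ⟩
  sum (map (λ w → indicator (isKernelPhase (phaseOf w))) (positions (n + 0)))
    ≡⟨ sym (kernelCompletions-correct n 0) ⟩
  kernelCompletions n 0 start + 0
    ≡⟨ +-identityʳ _ ⟩
  kernelCompletions n 0 start ∎

Σ-threshold : ∀ m p A B → p ≤ m → Σ< m (λ i → if suc i ≤ᵇ p then A else B) ≡ p * A + (m ∸ p) * B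
Σ-threshold m p A B p≤m = begin
  Σ< m f                                        ≡⟨ cong (λ k → Σ< k f) (sym (m+[n∸m]≡n p≤m)) ⟩
  Σ< (p + (m ∸ p)) f                            ≡⟨ Σ-split p (m ∸ p) f ⟩
  Σ< p f + Σ< (m ∸ p) (λ i → f (p + i))         ≡⟨ cong₂ _+_ (Σ-cong p below) (Σ-cong′ (m ∸ p) above) ⟩
  Σ< p (λ _ → A) + Σ< (m ∸ p) (λ _ → B)         ≡⟨ cong₂ _+_ (Σ-const p A) (Σ-const (m ∸ p) B) ⟩
  p * A + (m ∸ p) * B                           ∎
  where
  f : ℕ → ℕ
  f i = if suc i ≤ᵇ p then A else B
  below : ∀ i → i < p → f i ≡ A
  below i i<p = cong (λ b → if b then A else B) (≤ᵇ-true i<p)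
  above : ∀ i → f (p + i) ≡ B
  above i = cong (λ b → if b then A else B) (≤ᵇ-false {suc (p + i)} {p} (s≤s (m≤m+n p i)))

if-kernel : ∀ d j p (b : Bool) →
  kernelCompletions d j (if b then kernel else nonKernel p)
  ≡ (if b then kernelCompletions d j kernel else kernelCompletions d j (nonKernel p))
if-kernel d j p true  = refl
if-kernel d j p false = refl

-- From a non-kernel phase with pivot p, the p letters ≤ p lead to a kernel phase,
-- the other letters keep the phase.
kernelCompletions-nonKernel-step : ∀ d j p → p ≤ j →
  kernelCompletions (suc d) j (nonKernel p)
  ≡ p * kernelCompletions d (suc j) kernel + (suc j ∸ p) * kernelCompletions d (suc j) (nonKernel p)
kernelCompletions-nonKernel-step d j p p≤j = begin
  kernelCompletions (suc d) j (nonKernel p)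
    ≡⟨ sum-oneTo (λ x → kernelCompletions d (suc j) (advance (nonKernel p) x)) (suc j) ⟩
  Σ< (suc j) (λ i → kernelCompletions d (suc j) (if suc i ≤ᵇ p then kernel else nonKernel p))
    ≡⟨ Σ-cong′ (suc j) (λ i → if-kernel d (suc j) p (suc i ≤ᵇ p)) ⟩
  Σ< (suc j) (λ i → if suc i ≤ᵇ p then kernelCompletions d (suc j) kernel
                                   else kernelCompletions d (suc j) (nonKernel p))
    ≡⟨ Σ-threshold (suc j) p _ _ (m≤n⇒m≤1+n p≤j) ⟩
  p * kernelCompletions d (suc j) kernel + (suc j ∸ p) * kernelCompletions d (suc j) (nonKernel p) ∎

-- Unrolled: the next kernel phase is reached after e + 1 further letters, the first
-- e of them above the pivot (rising (j - p) e ways) and the last one not (p ways).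
kernelCompletions-nonKernel : ∀ d j p → p ≤ j →
  kernelCompletions d j (nonKernel p)
  ≡ Σ< d (λ e → rising (j ∸ p) e * (p * kernelCompletions (d ∸ suc e) (suc (j + e)) kernel))
kernelCompletions-nonKernel zero    j p p≤j = refl
kernelCompletions-nonKernel (suc d) j p p≤j = begin
  kernelCompletions (suc d) j (nonKernel p)
    ≡⟨ kernelCompletions-nonKernel-step d j p p≤j ⟩
  p * K d (suc j) + (suc j ∸ p) * kernelCompletions d (suc j) (nonKernel p)
    ≡⟨ cong₂ _+_ first-letter (cong ((suc j ∸ p) *_) (kernelCompletions-nonKernel d (suc j) p (m≤n⇒m≤1+n p≤j))) ⟩
  rising (j ∸ p) 0 * (p * K d (suc (j + 0))) + (suc j ∸ p) * Σ< d (λ e → rising (suc j ∸ p) e * (p * K (d ∸ suc e) (suc (suc j + e))))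
    ≡⟨ cong (rising (j ∸ p) 0 * (p * K d (suc (j + 0))) +_) (sym (trans (Σ-cong′ d later-letters) (Σ-*ˡ d (suc j ∸ p) _))) ⟩
  Σ< (suc d) (λ e → rising (j ∸ p) e * (p * K (suc d ∸ suc e) (suc (j + e)))) ∎
  where
  K : ℕ → ℕ → ℕ
  K d j = kernelCompletions d j kernel
  first-letter : p * K d (suc j) ≡ rising (j ∸ p) 0 * (p * K d (suc (j + 0)))
  first-letter rewrite +-identityʳ j = sym (+-identityʳ _)
  later-letters : ∀ e → rising (j ∸ p) (suc e) * (p * K (d ∸ suc e) (suc (j + suc e)))
                        ≡ (suc j ∸ p) * (rising (suc j ∸ p) e * (p * K (d ∸ suc e) (suc (suc j + e))))
  later-letters e rewrite +-suc j e =
    trans (*-assoc (suc (j ∸ p)) (rising (suc (j ∸ p)) e) _)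
          (cong (λ c → c * (rising c e * (p * K (d ∸ suc e) (suc (suc (j + e)))))) (sym (+-∸-assoc 1 p≤j)))

kernelCompletions-kernel : ∀ d j →
  kernelCompletions (suc d) j kernel
  ≡ Σ< d (λ e → weightedRisingSum j e * kernelCompletions (d ∸ suc e) (j + suc (suc e)) kernel)
kernelCompletions-kernel d j = begin
  kernelCompletions (suc d) j kernel
    ≡⟨ sum-oneTo (λ x → kernelCompletions d (suc j) (nonKernel x)) (suc j) ⟩
  Σ< (suc j) (λ i → kernelCompletions d (suc j) (nonKernel (suc i)))
    ≡⟨ Σ-cong (suc j) (λ i i≤j → kernelCompletions-nonKernel d (suc j) (suc i) i≤j) ⟩
  Σ< (suc j) (λ i → Σ< d (λ e → rising (j ∸ i) e * (suc i * K (d ∸ suc e) (suc (suc j + e)))))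
    ≡⟨ Σ-swap (suc j) d (λ i e → rising (j ∸ i) e * (suc i * K (d ∸ suc e) (suc (suc j + e)))) ⟩
  Σ< d (λ e → Σ< (suc j) (λ i → rising (j ∸ i) e * (suc i * K (d ∸ suc e) (suc (suc j + e)))))
    ≡⟨ Σ-cong′ d factor ⟩
  Σ< d (λ e → weightedRisingSum j e * K (d ∸ suc e) (j + suc (suc e))) ∎
  where
  K : ℕ → ℕ → ℕ
  K d j = kernelCompletions d j kernel
  factor : ∀ e → Σ< (suc j) (λ i → rising (j ∸ i) e * (suc i * K (d ∸ suc e) (suc (suc j + e))))
               ≡ weightedRisingSum j e * K (d ∸ suc e) (j + suc (suc e))
  factor e rewrite two-later j e =
    trans (Σ-cong′ (suc j) (λ i → reorder (rising (j ∸ i) e) (suc i) V))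
          (Σ-*ʳ (suc j) V (λ i → suc i * rising (j ∸ i) e))
    where
    V : ℕ
    V = K (d ∸ suc e) (j + suc (suc e))
    reorder : ∀ r s v → r * (s * v) ≡ s * r * v
    reorder = solve-∀

chainWeights-truncate : ∀ n b t m → n ≡ b + t → t < m →
  Σ< m (λ l → chainWeight n l b) ≡ Σ< (suc t) (λ l → chainWeight n l b)
chainWeights-truncate n b t m refl t<m =
  Σ-truncate (suc t) m _ t<m (λ l t<l → chainWeight-long (b + t) l b (+-monoʳ-< b (<-≤-trans t<l (m≤m+n l l))))

-- By strong induction on
-- the number d of letters to add: the first gap of the chain is the distance to
-- the next kernel phase.
kernelCompletions≡chains : ∀ n d j → j + d ≡ n →
  kernelCompletions d j kernel ≡ Σ< (suc d) (λ l → chainWeight n l j)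
kernelCompletions≡chains n = <-rec Goal completions
  where
  Goal : ℕ → Set
  Goal d = ∀ j → j + d ≡ n → kernelCompletions d j kernel ≡ Σ< (suc d) (λ l → chainWeight n l j)
  completions : ∀ d → (∀ {d′} → d′ < d → Goal d′) → Goal d
  completions zero    _  j j+0≡n rewrite ≡ᵇ-true (trans (sym (+-identityʳ j)) j+0≡n) = refl
  completions (suc d) ih j j+d≡n = begin
    kernelCompletions (suc d) j kernel
      ≡⟨ kernelCompletions-kernel d j ⟩
    Σ< d (λ e → weightedRisingSum j e * kernelCompletions (d ∸ suc e) (b e) kernel)
      ≡⟨ Σ-cong d (λ e e<d → cong₂ _*_ (weightedRisingSum≡gapWeight j e) (after-first-gap e e<d)) ⟩
    Σ< d (λ e → gapWeight j (b e) * Σ< (suc d) (λ l → chainWeight n l (b e)))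
      ≡⟨ sym (Σ-cong′ d (λ e → Σ-*ˡ (suc d) (gapWeight j (b e)) (λ l → chainWeight n l (b e)))) ⟩
    Σ< d (λ e → Σ< (suc d) (λ l → gapWeight j (b e) * chainWeight n l (b e)))
      ≡⟨ Σ-swap d (suc d) (λ e l → gapWeight j (b e) * chainWeight n l (b e)) ⟩
    Σ< (suc d) (λ l → Σ< d (λ e → gapWeight j (b e) * chainWeight n l (b e)))
      ≡⟨ sym (Σ-cong′ (suc d) (λ l → chainWeight-step n j d l n≡1+j+d)) ⟩
    Σ< (suc d) (λ l → chainWeight n (suc l) j)
      ≡⟨ cong (_+ Σ< (suc d) (λ l → chainWeight n (suc l) j)) (sym no-empty-chain) ⟩
    Σ< (suc (suc d)) (λ l → chainWeight n l j) ∎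
    where
    b : ℕ → ℕ
    b e = j + suc (suc e)
    n≡1+j+d : n ≡ suc (j + d)
    n≡1+j+d = trans (sym j+d≡n) (+-suc j d)
    rest : ∀ e → e < d → b e + (d ∸ suc e) ≡ n
    rest e e<d = trans (+-assoc j (suc (suc e)) (d ∸ suc e)) (trans (cong (λ z → j + suc z) (m+[n∸m]≡n e<d)) j+d≡n)
    after-first-gap : ∀ e → e < d →
      kernelCompletions (d ∸ suc e) (b e) kernel ≡ Σ< (suc d) (λ l → chainWeight n l (b e))
    after-first-gap e e<d =
      trans (ih (s≤s (m∸n≤m d (suc e))) (b e) (rest e e<d))
            (sym (chainWeights-truncate n (b e) (d ∸ suc e) (suc d) (sym (rest e e<d)) (s≤s (m∸n≤m d (suc e)))))
    no-empty-chain : chainWeight n 0 j ≡ 0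
    no-empty-chain = cong indicator (≡ᵇ-false (λ j≡n → <-irrefl j≡n (subst (j <_) (sym n≡1+j+d) (s≤s (m≤m+n j d)))))

half-bound : ∀ m → m ≤ suc (m / 2 + m / 2)
half-bound m =
  ≤-trans (≤-reflexive (m≡m%n+[m/n]*n m 2))
          (≤-trans (+-monoˡ-≤ (m / 2 * 2) (s≤s⁻¹ (m%n<n m 2))) (≤-reflexive (cong suc (double (m / 2)))))
  where
  double : ∀ L → L * 2 ≡ L + L
  double = solve-∀

-- The only position of rank 1 is a kernel position, so κ_n counts the kernel
-- completions of a kernel phase at length 1, i.e. the chains from 1 to n; the
-- chain with no step does not reach n ≥ 2 (both facts hold by computation), and
-- chains with more than ⌊(n-1)/2⌋ steps vanish.
theorem6p2 : (n : ℕ) → 2 ≤ n → κ n ≡ rhs n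
theorem6p2 (suc (suc m′)) (s≤s (s≤s z≤n)) = begin
  κ n                                    ≡⟨ κ≡kernelCompletions n ⟩
  kernelCompletions m 1 kernel + 0       ≡⟨ +-identityʳ _ ⟩
  kernelCompletions m 1 kernel           ≡⟨ kernelCompletions≡chains n m 1 refl ⟩
  Σ< m (λ k → chainWeight n (suc k) 1)   ≡⟨ Σ-truncate L m _ (m/n≤m m 2) too-many-steps ⟩
  Σ< L (λ k → chainWeight n (suc k) 1)   ≡⟨ sym (Σ-cong′ L (innerSum≡chainWeight m)) ⟩
  Σ< L (innerSum n)                      ≡⟨ sym (sum-upTo (innerSum n) L) ⟩
  rhs n                                  ∎
  where
  m n L : ℕ
  m = suc m′
  n = suc m
  L = m / 2
  too-many-steps : ∀ k → L ≤ k → chainWeight n (suc k) 1 ≡ 0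
  too-many-steps k L≤k =
    chainWeight-long n (suc k) 1
      (s≤s (s≤s (≤-trans (half-bound m) (≤-trans (s≤s (+-mono-≤ L≤k L≤k)) (≤-reflexive (sym (+-suc k k)))))))
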